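{- Let $\pi:Y\to X$ be a map of finite sets, and for $x\in X$ let $Y_x=\pi^{ -1}(x)$. Let $C$ be a Plott choice function on $X$, and for each $x\in X$ let $C_x$ be a non-empty-valued Plott choice function on $Y_x$. Define a choice function $D$ on $Y$ by $$D(B)=\bigcup_{x\in C(\pi(B))} C_x(B\cap Y_x)\qquad (B\subseteq Y).$$ Then $D$ is a Plott choice function.
   Context: A choice function (CF) on a set $X$ is a map $C:2^X\to 2^X$ with $C(A)\subseteq A$ for all $A\subseteq X$. $C$ is consistent if $C(A)\subseteq B\subseteq A$ implies $C(B)=C(A)$; $C$ is substitutable if $B\subseteq A$ implies $C(A)\cap B\subseteq C(B)$. A Plott CF is a CF that is both consistent and substitutable. A CF $C$ is non-empty-valued if $C(A)\neq\emptyset$ whenever $A\neq\emptyset$. -}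

module Defs where

open import Data.Nat using (ℕ)
open import Data.Fin using (Fin; _≟_)
open import Data.Fin.Subset using (Subset; _∈_; _⊆_; _∩_; ⋃; ⊤; Nonempty)
open import Data.Fin.Subset.Properties using (_∈?_)
open import Data.Fin.Properties using (any?)
open import Data.Vec using (tabulate)
open import Data.List using (map; filter; allFin)
open import Data.Product using (_×_)
open import Relation.Nullary using (does)
open import Relation.Nullary.Decidable using (_×-dec_)
open import Relation.Binary.PropositionalEquality using (_≡_)

-- A choice function on a subset U of Fin m is modelled as a map
-- f : Subset m → Subset m of which only the values on subsets A ⊆ U matter;
-- all axioms are quantified over subsets of U only.

module _ {m : ℕ} (U : Subset m) (f : Subset m → Subset m) where

  IsChoiceFunctionOn : Set
  IsChoiceFunctionOn = ∀ A → A ⊆ U → f A ⊆ A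

  ConsistentOn : Set
  ConsistentOn = ∀ A B → A ⊆ U → f A ⊆ B → B ⊆ A → f B ≡ f A

  SubstitutableOn : Set
  SubstitutableOn = ∀ A B → A ⊆ U → B ⊆ A → f A ∩ B ⊆ f B

  NonEmptyValuedOn : Set
  NonEmptyValuedOn = ∀ A → A ⊆ U → Nonempty A → Nonempty (f A)

  PlottOn : Set
  PlottOn = IsChoiceFunctionOn × ConsistentOn × SubstitutableOn

Plott : {m : ℕ} → (Subset m → Subset m) → Set
Plott f = PlottOn ⊤ f

image : {m n : ℕ} → (Fin m → Fin n) → Subset m → Subset n
image π B = tabulate λ x → does (any? λ y → (y ∈? B) ×-dec (π y ≟ x))

fibre : {m n : ℕ} → (Fin m → Fin n) → Fin n → Subset m
fibre π x = tabulate λ y → does (π y ≟ x)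

D : {m n : ℕ} → (Fin m → Fin n) → (Subset n → Subset n)
  → (Fin n → Subset m → Subset m) → Subset m → Subset m
D {n = n} π C Cx B =
  ⋃ (map (λ x → Cx x (B ∩ fibre π x))
         (filter (λ x → x ∈? C (image π B)) (allFin n)))

-- Each x ∈ C(π B) contributes the non-empty set C_x(B ∩ Y_x) to D(B), so π(D B) covers
-- C(π B). Hence if D(B) ⊆ B' ⊆ B then C(π B) ⊆ π B' ⊆ π B, consistency of C gives
-- C(π B') = C(π B), and consistency of each C_x, applied fibrewise, gives D(B') = D(B).
-- Substitutability is checked pointwise: a chosen y ∈ B' lies over some x ∈ C(π B) ∩ π B',
-- which survives in C(π B'), and y survives in C_x(B' ∩ Y_x).
module Submission where

open import Defs
open import Data.Nat using (ℕ)
open import Data.Bool.Properties using (T-≡)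
open import Data.Fin using (Fin; _≟_)
open import Data.Fin.Subset using (Subset; _∈_; _⊆_; _∩_; ⋃; ⊤)
open import Data.Fin.Subset.Properties
  using (_∈?_; ∉⊥; x∈p∪q⁻; x∈p∪q⁺; x∈p∩q⁺; x∈p∩q⁻; p∩q⊆p; p∩q⊆q; ∈⊤; ⊆-antisym)
open import Data.Fin.Properties using (any?)
open import Data.Vec using (tabulate)
open import Data.Vec.Properties using (lookup∘tabulate; lookup⇒[]=; []=⇒lookup)
open import Data.List using (List; []; _∷_; map; filter; allFin)
import Data.List.Membership.Propositional as List
open import Data.List.Membership.Propositional.Properties using (∈-map∘filter⁻; ∈-map∘filter⁺; ∈-allFin)
open import Data.List.Relation.Unary.Any using (here; there)
open import Data.Product using (_×_; _,_; proj₁; proj₂; ∃)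
open import Data.Sum using (inj₁; inj₂)
open import Data.Empty using (⊥-elim)
open import Function.Bundles using (Equivalence)
open import Relation.Nullary using (Dec; does)
open import Relation.Nullary.Decidable using (_×-dec_; dec-true; isYes≗does; toWitness)
open import Relation.Unary using (Pred)
open import Relation.Binary.PropositionalEquality using (_≡_; refl; sym; trans; subst)

∈-tabulate-does⁺ : ∀ {k ℓ} {P : Pred (Fin k) ℓ} (P? : ∀ x → Dec (P x)) {x} →
                   P x → x ∈ tabulate (λ y → does (P? y))
∈-tabulate-does⁺ P? {x} px =
  lookup⇒[]= x _ (trans (lookup∘tabulate (λ y → does (P? y)) x) (dec-true (P? x) px))

∈-tabulate-does⁻ : ∀ {k ℓ} {P : Pred (Fin k) ℓ} (P? : ∀ x → Dec (P x)) {x} →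
                   x ∈ tabulate (λ y → does (P? y)) → P x
∈-tabulate-does⁻ P? {x} x∈ = toWitness {a? = P? x}
  (Equivalence.from T-≡ (trans (isYes≗does (P? x))
    (trans (sym (lookup∘tabulate (λ y → does (P? y)) x)) ([]=⇒lookup x∈))))

x∈⋃⁺ : ∀ {k} {ps : List (Subset k)} {p x} → p List.∈ ps → x ∈ p → x ∈ ⋃ ps
x∈⋃⁺ (here refl) x∈p = x∈p∪q⁺ (inj₁ x∈p)
x∈⋃⁺ (there p∈) x∈p = x∈p∪q⁺ (inj₂ (x∈⋃⁺ p∈ x∈p))

x∈⋃⁻ : ∀ {k} (ps : List (Subset k)) {x} → x ∈ ⋃ ps → ∃ λ p → p List.∈ ps × x ∈ p
x∈⋃⁻ []       x∈ = ⊥-elim (∉⊥ x∈)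
x∈⋃⁻ (p ∷ ps) x∈ with x∈p∪q⁻ p (⋃ ps) x∈
... | inj₁ x∈p = p , here refl , x∈p
... | inj₂ x∈⋃ps with x∈⋃⁻ ps x∈⋃ps
...   | q , q∈ , x∈q = q , there q∈ , x∈q

∩-monoˡ-⊆ : ∀ {k} {p q : Subset k} (r : Subset k) → p ⊆ q → p ∩ r ⊆ q ∩ r
∩-monoˡ-⊆ {p = p} r p⊆q x∈ = let x∈p , x∈r = x∈p∩q⁻ p r x∈ in x∈p∩q⁺ (p⊆q x∈p , x∈r)

module _ {m n : ℕ} (π : Fin m → Fin n) where

  ∈-fibre⁺ : ∀ {x y} → π y ≡ x → y ∈ fibre π x
  ∈-fibre⁺ {x} = ∈-tabulate-does⁺ (λ y → π y ≟ x)

  ∈-fibre⁻ : ∀ {x y} → y ∈ fibre π x → π y ≡ x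
  ∈-fibre⁻ {x} = ∈-tabulate-does⁻ (λ y → π y ≟ x)

  ∈-image⁺ : ∀ {B y} → y ∈ B → π y ∈ image π B
  ∈-image⁺ {B} y∈B = ∈-tabulate-does⁺ (λ x → any? λ z → (z ∈? B) ×-dec (π z ≟ x)) (_ , y∈B , refl)

  ∈-image⁻ : ∀ {B x} → x ∈ image π B → ∃ λ y → y ∈ B × π y ≡ x
  ∈-image⁻ {B} = ∈-tabulate-does⁻ (λ x → any? λ z → (z ∈? B) ×-dec (π z ≟ x))

  image-mono : ∀ {B B′} → B′ ⊆ B → image π B′ ⊆ image π B
  image-mono B′⊆B x∈ with ∈-image⁻ x∈
  ... | _ , y∈B′ , refl = ∈-image⁺ (B′⊆B y∈B′)

  restriction-to-fibre : ∀ {f : Subset m → Subset m} x → IsChoiceFunctionOn (fibre π x) f →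
                         ∀ {B y} → y ∈ f (B ∩ fibre π x) → y ∈ B × π y ≡ x
  restriction-to-fibre x f-choice {B} y∈ =
    let y∈B∩Yx = f-choice (B ∩ fibre π x) (p∩q⊆q B _) y∈
    in p∩q⊆p B _ y∈B∩Yx , ∈-fibre⁻ (p∩q⊆q B _ y∈B∩Yx)

  module _ (C : Subset n → Subset n) (Cx : Fin n → Subset m → Subset m) where

    private
      chosen-parts : Subset m → List (Subset m)
      chosen-parts B = map (λ x → Cx x (B ∩ fibre π x)) (filter (λ x → x ∈? C (image π B)) (allFin n))

    ∈-D⁺ : ∀ {B x y} → x ∈ C (image π B) → y ∈ Cx x (B ∩ fibre π x) → y ∈ D π C Cx B
    ∈-D⁺ {B} {x} x∈C y∈ = x∈⋃⁺
      (∈-map∘filter⁺ (λ x → Cx x (B ∩ fibre π x)) (λ x → x ∈? C (image π B)) {f = λ x → Cx x (B ∩ fibre π x)}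
        (x , ∈-allFin x , refl , x∈C))
      y∈

    ∈-D⁻ : ∀ {B y} → y ∈ D π C Cx B → ∃ λ x → x ∈ C (image π B) × y ∈ Cx x (B ∩ fibre π x)
    ∈-D⁻ {B} y∈ with x∈⋃⁻ (chosen-parts B) y∈
    ... | _ , p∈ , y∈p
      with ∈-map∘filter⁻ (λ x → Cx x (B ∩ fibre π x)) (λ x → x ∈? C (image π B)) {f = λ x → Cx x (B ∩ fibre π x)} {xs = allFin n} p∈
    ...   | x , _ , refl , x∈C = x , x∈C , y∈p

    module _ (Cx-choice : ∀ x → IsChoiceFunctionOn (fibre π x) (Cx x)) where

      D-choice : IsChoiceFunctionOn ⊤ (D π C Cx)
      D-choice B _ y∈ with ∈-D⁻ y∈
      ... | x , _ , y∈Cx = proj₁ (restriction-to-fibre x (Cx-choice x) y∈Cx)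

      D-substitutable : SubstitutableOn ⊤ C → (∀ x → SubstitutableOn (fibre π x) (Cx x)) →
                        SubstitutableOn ⊤ (D π C Cx)
      D-substitutable C-subst Cx-subst B B′ _ B′⊆B y∈ with x∈p∩q⁻ (D π C Cx B) B′ y∈
      ... | y∈D , y∈B′ with ∈-D⁻ y∈D
      ... | x , x∈C , y∈Cx with restriction-to-fibre x (Cx-choice x) y∈Cx
      ... | _ , refl = ∈-D⁺
        (C-subst (image π B) (image π B′) (λ _ → ∈⊤) (image-mono B′⊆B)
          (x∈p∩q⁺ (x∈C , ∈-image⁺ y∈B′)))
        (Cx-subst x (B ∩ fibre π x) (B′ ∩ fibre π x) (p∩q⊆q B _) (∩-monoˡ-⊆ _ B′⊆B)
          (x∈p∩q⁺ (y∈Cx , x∈p∩q⁺ (y∈B′ , ∈-fibre⁺ refl))))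

      C-image⊆image-D : IsChoiceFunctionOn ⊤ C → (∀ x → NonEmptyValuedOn (fibre π x) (Cx x)) →
                        ∀ B → C (image π B) ⊆ image π (D π C Cx B)
      C-image⊆image-D C-choice Cx-nonempty B {x} x∈C with ∈-image⁻ (C-choice (image π B) (λ _ → ∈⊤) x∈C)
      ... | y , y∈B , refl with Cx-nonempty x (B ∩ fibre π x) (p∩q⊆q B _) (y , x∈p∩q⁺ (y∈B , ∈-fibre⁺ refl))
      ... | z , z∈Cx = subst (_∈ image π (D π C Cx B)) (proj₂ (restriction-to-fibre x (Cx-choice x) z∈Cx))
                             (∈-image⁺ (∈-D⁺ x∈C z∈Cx))

      D-consistent : IsChoiceFunctionOn ⊤ C → ConsistentOn ⊤ C →
                     (∀ x → ConsistentOn (fibre π x) (Cx x)) →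
                     (∀ x → NonEmptyValuedOn (fibre π x) (Cx x)) →
                     ConsistentOn ⊤ (D π C Cx)
      D-consistent C-choice C-cons Cx-cons Cx-nonempty B B′ _ D⊆B′ B′⊆B = ⊆-antisym D′⊆D D⊆D′
        where
        C-image-eq : C (image π B′) ≡ C (image π B)
        C-image-eq = C-cons (image π B) (image π B′) (λ _ → ∈⊤)
          (λ x∈C → image-mono D⊆B′ (C-image⊆image-D C-choice Cx-nonempty B x∈C))
          (image-mono B′⊆B)

        Cx-eq : ∀ {x} → x ∈ C (image π B) → Cx x (B′ ∩ fibre π x) ≡ Cx x (B ∩ fibre π x)
        Cx-eq {x} x∈C = Cx-cons x (B ∩ fibre π x) (B′ ∩ fibre π x) (p∩q⊆q B _)
          (λ y∈Cx → x∈p∩q⁺ (D⊆B′ (∈-D⁺ x∈C y∈Cx) , ∈-fibre⁺ (proj₂ (restriction-to-fibre x (Cx-choice x) y∈Cx))))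
          (∩-monoˡ-⊆ _ B′⊆B)

        D′⊆D : D π C Cx B′ ⊆ D π C Cx B
        D′⊆D {y} y∈ with ∈-D⁻ y∈
        ... | x , x∈C′ , y∈Cx = let x∈C = subst (x ∈_) C-image-eq x∈C′ in
          ∈-D⁺ x∈C (subst (y ∈_) (Cx-eq x∈C) y∈Cx)

        D⊆D′ : D π C Cx B ⊆ D π C Cx B′
        D⊆D′ {y} y∈ with ∈-D⁻ y∈
        ... | x , x∈C , y∈Cx =
          ∈-D⁺ (subst (x ∈_) (sym C-image-eq) x∈C) (subst (y ∈_) (sym (Cx-eq x∈C)) y∈Cx)

proposition2 : {m n : ℕ} (π : Fin m → Fin n) (C : Subset n → Subset n)
    (Cx : Fin n → Subset m → Subset m)
    → Plott C
    → (∀ x → PlottOn (fibre π x) (Cx x))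
    → (∀ x → NonEmptyValuedOn (fibre π x) (Cx x))
    → Plott (D π C Cx)
proposition2 π C Cx (C-choice , C-cons , C-subst) Cx-plott Cx-nonempty =
    D-choice π C Cx Cx-choice
  , D-consistent π C Cx Cx-choice C-choice C-cons (λ x → proj₁ (proj₂ (Cx-plott x))) Cx-nonempty
  , D-substitutable π C Cx Cx-choice C-subst (λ x → proj₂ (proj₂ (Cx-plott x)))
  where
  Cx-choice : ∀ x → IsChoiceFunctionOn (fibre π x) (Cx x)
  Cx-choice x = proj₁ (Cx-plott x)
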